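{- For every integer $h\ge 1$, $L(\mathbf{URecMAJ}_3^h) = L_m(\mathbf{URecMAJ}_3^h) = 4h+1$.
   Context: $\mathbf{MAJ}_3$ is the 3-bit majority function (outputs $1$ iff at least two inputs are $1$). The unbalanced recursive ternary majority functions $\mathbf{URecMAJ}_3^h:\{0,1\}^{2h+1}\to\{0,1\}$ are defined by $\mathbf{URecMAJ}_3^1=\mathbf{MAJ}_3$ and, for $h\ge 2$, $\mathbf{URecMAJ}_3^h(x_1,\dots,x_{2h+1}) = \mathbf{MAJ}_3(\mathbf{URecMAJ}_3^{h-1}(x_1,\dots,x_{2h-1}), x_{2h}, x_{2h+1})$. A formula is a binary tree whose leaves are labeled by literals (variables or negated variables) and whose internal nodes are labeled by $\wedge$ or $\vee$; it is monotone if it has no negated variables; its size is its number of leaves. $L(f)$ (resp. $L_m(f)$) is the minimum size of a formula (resp. monotone formula) computing $f$. -}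

module Defs where

open import Data.Nat using (ℕ; zero; suc; _≤_)
open import Data.Fin using (Fin; zero; suc; inject₁; fromℕ)
open import Data.Bool using (Bool; true; false; _∧_; _∨_; not)
open import Data.Product using (Σ; _×_; _,_)
open import Relation.Binary.PropositionalEquality using (_≡_)

MAJ3 : Bool → Bool → Bool → Bool
MAJ3 a b c = (a ∧ b) ∨ (a ∧ c) ∨ (b ∧ c)

-- number of variables of URecMAJ_3^h, i.e. 2h+1 (recursively, so that it computes)
nv : ℕ → ℕ
nv zero = 1
nv (suc h) = suc (suc (nv h))

-- URecMAJ_3^h on variables x_1..x_{2h+1}, represented by indices 0..2h.
-- The value at h = 0 (the projection x_1) is a junk value; the theorem only uses h ≥ 1.
URecMAJ : (h : ℕ) → (Fin (nv h) → Bool) → Bool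
URecMAJ zero x = x zero
URecMAJ (suc zero) x = MAJ3 (x zero) (x (suc zero)) (x (suc (suc zero)))
URecMAJ (suc (suc h)) x =
  MAJ3 (URecMAJ (suc h) (λ i → x (inject₁ (inject₁ i))))
       (x (inject₁ (fromℕ (nv (suc h)))))
       (x (fromℕ (suc (nv (suc h)))))

data Formula (n : ℕ) : Set where
  pos  : Fin n → Formula n
  neg  : Fin n → Formula n
  and  : Formula n → Formula n → Formula n
  or   : Formula n → Formula n → Formula n

eval : {n : ℕ} → Formula n → (Fin n → Bool) → Bool
eval (pos i) x = x i
eval (neg i) x = not (x i)
eval (and φ ψ) x = eval φ x ∧ eval ψ x
eval (or φ ψ) x = eval φ x ∨ eval ψ x

size : {n : ℕ} → Formula n → ℕ
size (pos i) = 1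
size (neg i) = 1
size (and φ ψ) = size φ Data.Nat.+ size ψ
size (or φ ψ) = size φ Data.Nat.+ size ψ

data Monotone {n : ℕ} : Formula n → Set where
  pos : (i : Fin n) → Monotone (pos i)
  and : {φ ψ : Formula n} → Monotone φ → Monotone ψ → Monotone (and φ ψ)
  or  : {φ ψ : Formula n} → Monotone φ → Monotone ψ → Monotone (or φ ψ)

Computes : {n : ℕ} → Formula n → ((Fin n → Bool) → Bool) → Set
Computes φ f = ∀ x → eval φ x ≡ f x

FormulaSizeIs : {n : ℕ} → ((Fin n → Bool) → Bool) → ℕ → Set
FormulaSizeIs {n} f s =
  Σ (Formula n) (λ φ → Computes φ f × size φ ≡ s)
  × (∀ (φ : Formula n) → Computes φ f → s ≤ size φ)

MonotoneFormulaSizeIs : {n : ℕ} → ((Fin n → Bool) → Bool) → ℕ → Set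
MonotoneFormulaSizeIs {n} f s =
  Σ (Formula n) (λ φ → Monotone φ × Computes φ f × size φ ≡ s)
  × (∀ (φ : Formula n) → Monotone φ → Computes φ f → s ≤ size φ)

-- Writing G ∧ (u ∨ v) ∨ (u ∧ v) for MAJ₃(G, u, v) adds four leaves per level, which gives
-- the upper bound. For the lower bound, by induction it suffices that every formula for
-- MAJ₃(G(y), u, v), with G non-constant, has at least L(G) + 4 leaves. Setting u = 1, v = 0
-- turns it into a formula for G, so at least L(G) leaves carry y-variables; if u and v both
-- occur twice we are done. Otherwise u, say, occurs exactly once (it must occur). Let P be the
-- conjunction of the siblings of the ∧-gates and Q the disjunction of the siblings of the
-- ∨-gates on the path to that leaf. The majority forces the leaf to be positive, P|v=0 = G and
-- Q|v=1 = G, and both P and Q to depend on v; this gives 1 + 2 + 2 L(G) ≥ L(G) + 4 leaves.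
module Submission where

open import Defs
open import Data.Nat using (ℕ; zero; suc; _≤_; _+_; _*_; z≤n; s≤s; _≤?_)
open import Data.Nat.Properties
open import Algebra.Properties.CommutativeSemigroup +-commutativeSemigroup using (interchange; x∙yz≈y∙xz)
open import Data.Fin using (Fin; zero; suc; inject₁; fromℕ)
open import Data.Bool using (Bool; true; false; _∧_; _∨_; not; _xor_; T)
open import Data.Bool.Properties using (∧-comm; ∨-comm; ∨-assoc; ∧-zeroʳ; ∧-identityʳ; ∨-zeroʳ; ∨-identityʳ)
open import Data.Product using (_×_; _,_; proj₁; proj₂)
open import Data.Sum using (_⊎_; inj₁; inj₂; [_,_]′)
open import Data.Empty using (⊥-elim)
open import Function using (id; _∘_)
open import Relation.Binary.PropositionalEquality
open import Relation.Nullary using (¬_; yes; no)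

private
  variable
    n N : ℕ

m+n≡1⇒m≡0∧n≡1∨m≡1∧n≡0 : ∀ m {n} → m + n ≡ 1 → (m ≡ 0 × n ≡ 1) ⊎ (m ≡ 1 × n ≡ 0)
m+n≡1⇒m≡0∧n≡1∨m≡1∧n≡0 zero            n≡1 = inj₁ (refl , n≡1)
m+n≡1⇒m≡0∧n≡1∨m≡1∧n≡0 (suc zero) {zero} _   = inj₂ (refl , refl)

false≢true : false ≢ true
false≢true ()

literal : Bool → Bool → Bool
literal true  b = b
literal false b = not b

MAJ3-cong : ∀ {g g' a a' b b'} → g ≡ g' → a ≡ a' → b ≡ b' → MAJ3 g a b ≡ MAJ3 g' a' b'
MAJ3-cong refl refl refl = refl

MAJ3-factor : ∀ a b c → MAJ3 a b c ≡ (a ∧ (b ∨ c)) ∨ (b ∧ c)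
MAJ3-factor false b c = refl
MAJ3-factor true  b c = sym (∨-assoc b c (b ∧ c))

MAJ3-comm : ∀ g a b → MAJ3 g a b ≡ MAJ3 g b a
MAJ3-comm g a b = begin
  MAJ3 g a b                  ≡⟨ MAJ3-factor g a b ⟩
  (g ∧ (a ∨ b)) ∨ (a ∧ b)    ≡⟨ cong₂ (λ s t → (g ∧ s) ∨ t) (∨-comm a b) (∧-comm a b) ⟩
  (g ∧ (b ∨ a)) ∨ (b ∧ a)    ≡⟨ sym (MAJ3-factor g b a) ⟩
  MAJ3 g b a                  ∎
  where open ≡-Reasoning

MAJ3-idem : ∀ b → MAJ3 b b b ≡ b
MAJ3-idem false = refl
MAJ3-idem true  = refl

MAJ3-true-false : ∀ g → MAJ3 g true false ≡ g
MAJ3-true-false false = refl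
MAJ3-true-false true  = refl

-- Paths to a single occurrence of a literal

-- c₀ and c₁ are the values of a formula when its distinguished literal is 0 and 1; p and q are
-- the values of the conjunction of the ∧-siblings and the disjunction of the ∨-siblings on the
-- path to it. The disjuncts are ordered so that the steps below hold by computation.
record Path (c₀ c₁ p q : Bool) : Set where
  field
    low  : T (not c₀ ∨ q)
    high : T (c₁ ∨ not p)
    jump : T (not (c₀ xor c₁) ∨ (p ∧ not q))

path-leaf : Path false true true false
path-leaf = _

path-∧ : ∀ {r r' c₀ c₁ p q} → r ≡ r' → Path c₀ c₁ p q → Path (r ∧ c₀) (r' ∧ c₁) (r ∧ p) q
path-∧ {false} refl _    = _
path-∧ {true}  refl path = path

path-∨ : ∀ {r r' c₀ c₁ p q} → r ≡ r' → Path c₀ c₁ p q → Path (r ∨ c₀) (r' ∨ c₁) p (r ∨ q)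
path-∨ {false} refl path = path
path-∨ {true}  refl _    = _

path-cong : ∀ {c₀ c₀' c₁ c₁' p q} → c₀ ≡ c₀' → c₁ ≡ c₁' → Path c₀ c₁ p q → Path c₀' c₁' p q
path-cong refl refl path = path

path-low : ∀ {c₁ p q} → Path true c₁ p q → q ≡ true
path-low {q = true} _ = refl

path-high : ∀ {c₀ p q} → Path c₀ false p q → p ≡ false
path-high {p = false} _ = refl

path-jump : ∀ {p q} → Path false true p q → p ≡ true × q ≡ false
path-jump {true} {false} _ = refl , refl

path-monotone : ∀ {p q} → ¬ Path true false p q
path-monotone {true}  record { high = () }
path-monotone {false} record { jump = () }

MajorityPath : (s g b p q : Bool) → Set
MajorityPath s g b p q = Path (MAJ3 g (literal s false) b) (MAJ3 g (literal s true) b) p q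

majorityPath-v0 : ∀ s g {p q} → MajorityPath s g false p q → p ≡ g
majorityPath-v0 false false path = path-high path
majorityPath-v0 false true  path = ⊥-elim (path-monotone path)
majorityPath-v0 true  false path = path-high path
majorityPath-v0 true  true  path = proj₁ (path-jump path)

majorityPath-v1 : ∀ s g {p q} → MajorityPath s g true p q → q ≡ g
majorityPath-v1 false false path = ⊥-elim (path-monotone path)
majorityPath-v1 false true  path = path-low path
majorityPath-v1 true  false path = proj₂ (path-jump path)
majorityPath-v1 true  true  path = path-low path

majorityPath-v0-true : ∀ s {g p q} → g ≡ true → MajorityPath s g false p q → q ≡ false
majorityPath-v0-true false refl path = ⊥-elim (path-monotone path)
majorityPath-v0-true true  refl path = proj₂ (path-jump path)

majorityPath-v1-false : ∀ s {g p q} → g ≡ false → MajorityPath s g true p q → p ≡ true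
majorityPath-v1-false false refl path = ⊥-elim (path-monotone path)
majorityPath-v1-false true  refl path = proj₁ (path-jump path)

data Formulaᶜ (n : ℕ) : Set where
  lit       : Bool → Fin n → Formulaᶜ n
  con       : Bool → Formulaᶜ n
  _∧ᶜ_ _∨ᶜ_ : Formulaᶜ n → Formulaᶜ n → Formulaᶜ n

eval-cong : ∀ (φ : Formula n) {x x'} → (∀ i → x i ≡ x' i) → eval φ x ≡ eval φ x'
eval-cong (pos i)   x≡x' = x≡x' i
eval-cong (neg i)   x≡x' = cong not (x≡x' i)
eval-cong (and φ ψ) x≡x' = cong₂ _∧_ (eval-cong φ x≡x') (eval-cong ψ x≡x')
eval-cong (or φ ψ)  x≡x' = cong₂ _∨_ (eval-cong φ x≡x') (eval-cong ψ x≡x')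

evalᶜ : Formulaᶜ n → (Fin n → Bool) → Bool
evalᶜ (lit s i) x = literal s (x i)
evalᶜ (con c)   x = c
evalᶜ (φ ∧ᶜ ψ)  x = evalᶜ φ x ∧ evalᶜ ψ x
evalᶜ (φ ∨ᶜ ψ)  x = evalᶜ φ x ∨ evalᶜ ψ x

embed : Formula n → Formulaᶜ n
embed (pos i)   = lit true i
embed (neg i)   = lit false i
embed (and φ ψ) = embed φ ∧ᶜ embed ψ
embed (or φ ψ)  = embed φ ∨ᶜ embed ψ

evalᶜ-embed : ∀ (φ : Formula n) x → evalᶜ (embed φ) x ≡ eval φ x
evalᶜ-embed (pos i)   x = refl
evalᶜ-embed (neg i)   x = refl
evalᶜ-embed (and φ ψ) x = cong₂ _∧_ (evalᶜ-embed φ x) (evalᶜ-embed ψ x)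
evalᶜ-embed (or φ ψ)  x = cong₂ _∨_ (evalᶜ-embed φ x) (evalᶜ-embed ψ x)

leaves : (Fin n → ℕ) → Formulaᶜ n → ℕ
leaves w (lit _ i) = w i
leaves w (con _)   = 0
leaves w (φ ∧ᶜ ψ)  = leaves w φ + leaves w ψ
leaves w (φ ∨ᶜ ψ)  = leaves w φ + leaves w ψ

leaves-cong : ∀ {w w' : Fin n → ℕ} → (∀ i → w i ≡ w' i) → ∀ φ → leaves w φ ≡ leaves w' φ
leaves-cong w≡w' (lit _ i) = w≡w' i
leaves-cong w≡w' (con _)   = refl
leaves-cong w≡w' (φ ∧ᶜ ψ)  = cong₂ _+_ (leaves-cong w≡w' φ) (leaves-cong w≡w' ψ)
leaves-cong w≡w' (φ ∨ᶜ ψ)  = cong₂ _+_ (leaves-cong w≡w' φ) (leaves-cong w≡w' ψ)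

leaves-+ : ∀ (w w' : Fin n → ℕ) φ → leaves (λ i → w i + w' i) φ ≡ leaves w φ + leaves w' φ
leaves-+ w w' (lit _ i) = refl
leaves-+ w w' (con _)   = refl
leaves-+ w w' (φ ∧ᶜ ψ)  =
  trans (cong₂ _+_ (leaves-+ w w' φ) (leaves-+ w w' ψ)) (interchange (leaves w φ) _ _ _)
leaves-+ w w' (φ ∨ᶜ ψ)  =
  trans (cong₂ _+_ (leaves-+ w w' φ) (leaves-+ w w' ψ)) (interchange (leaves w φ) _ _ _)

size-leaves : ∀ (φ : Formula n) → size φ ≡ leaves (λ _ → 1) (embed φ)
size-leaves (pos i)   = refl
size-leaves (neg i)   = refl
size-leaves (and φ ψ) = cong₂ _+_ (size-leaves φ) (size-leaves ψ)
size-leaves (or φ ψ)  = cong₂ _+_ (size-leaves φ) (size-leaves ψ)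

evalᶜ-local : ∀ (w : Fin n → ℕ) φ {x x'} → (∀ i → w i ≡ 0 → x i ≡ x' i) →
              leaves w φ ≡ 0 → evalᶜ φ x ≡ evalᶜ φ x'
evalᶜ-local w (lit s i) x≈x' none = cong (literal s) (x≈x' i none)
evalᶜ-local w (con _)   x≈x' none = refl
evalᶜ-local w (φ ∧ᶜ ψ)  x≈x' none = cong₂ _∧_
  (evalᶜ-local w φ x≈x' (m+n≡0⇒m≡0 (leaves w φ) none)) (evalᶜ-local w ψ x≈x' (m+n≡0⇒n≡0 (leaves w φ) none))
evalᶜ-local w (φ ∨ᶜ ψ)  x≈x' none = cong₂ _∨_
  (evalᶜ-local w φ x≈x' (m+n≡0⇒m≡0 (leaves w φ) none)) (evalᶜ-local w ψ x≈x' (m+n≡0⇒n≡0 (leaves w φ) none))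

occurs : ∀ (w : Fin n → ℕ) φ {x x'} → (∀ i → w i ≡ 0 → x i ≡ x' i) →
         evalᶜ φ x ≢ evalᶜ φ x' → 1 ≤ leaves w φ
occurs w φ x≈x' differ = n≢0⇒n>0 (differ ∘ evalᶜ-local w φ x≈x')

-- Restrictions

-- A partial assignment fixes a variable (inj₁ c) or renames it to a remaining variable (inj₂ j).
PartialAssignment : ℕ → ℕ → Set
PartialAssignment N n = Fin N → Bool ⊎ Fin n

extend : PartialAssignment N n → (Fin n → Bool) → Fin N → Bool
extend ρ y i = [ id , y ]′ (ρ i)

unfixed : PartialAssignment N n → Fin N → ℕ
unfixed ρ i = [ (λ _ → 0) , (λ _ → 1) ]′ (ρ i)

literalFormula : Bool → Fin n → Formula n
literalFormula true  j = pos j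
literalFormula false j = neg j

restrictLiteral : Bool → Bool ⊎ Fin n → Bool ⊎ Formula n
restrictLiteral s (inj₁ c) = inj₁ (literal s c)
restrictLiteral s (inj₂ j) = inj₂ (literalFormula s j)

_∧ʳ_ : Bool ⊎ Formula n → Bool ⊎ Formula n → Bool ⊎ Formula n
inj₁ false ∧ʳ _          = inj₁ false
inj₁ true  ∧ʳ r          = r
inj₂ φ     ∧ʳ inj₁ false = inj₁ false
inj₂ φ     ∧ʳ inj₁ true  = inj₂ φ
inj₂ φ     ∧ʳ inj₂ ψ     = inj₂ (and φ ψ)

_∨ʳ_ : Bool ⊎ Formula n → Bool ⊎ Formula n → Bool ⊎ Formula n
inj₁ true  ∨ʳ _          = inj₁ true
inj₁ false ∨ʳ r          = r
inj₂ φ     ∨ʳ inj₁ true  = inj₁ true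
inj₂ φ     ∨ʳ inj₁ false = inj₂ φ
inj₂ φ     ∨ʳ inj₂ ψ     = inj₂ (or φ ψ)

restrict : PartialAssignment N n → Formulaᶜ N → Bool ⊎ Formula n
restrict ρ (lit s i) = restrictLiteral s (ρ i)
restrict ρ (con c)   = inj₁ c
restrict ρ (φ ∧ᶜ ψ)  = restrict ρ φ ∧ʳ restrict ρ ψ
restrict ρ (φ ∨ᶜ ψ)  = restrict ρ φ ∨ʳ restrict ρ ψ

IsRestriction : PartialAssignment N n → Formulaᶜ N → Bool ⊎ Formula n → Set
IsRestriction ρ φ (inj₁ c) = ∀ y → evalᶜ φ (extend ρ y) ≡ c
IsRestriction ρ φ (inj₂ ψ) = (∀ y → eval ψ y ≡ evalᶜ φ (extend ρ y)) × size ψ ≤ leaves (unfixed ρ) φ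

eval-literalFormula : ∀ s (j : Fin n) y → eval (literalFormula s j) y ≡ literal s (y j)
eval-literalFormula true  j y = refl
eval-literalFormula false j y = refl

isRestriction-lit : ∀ (ρ : PartialAssignment N n) s i → IsRestriction ρ (lit s i) (restrict ρ (lit s i))
isRestriction-lit ρ s i with ρ i in ρi
... | inj₁ c = λ y → cong (literal s ∘ [ id , y ]′) ρi
... | inj₂ j = (λ y → trans (eval-literalFormula s j y) (cong (literal s ∘ [ id , y ]′) (sym ρi)))
             , ≤-reflexive (trans (size-literalFormula s) (cong [ (λ _ → 0) , (λ _ → 1) ]′ (sym ρi)))
  where
  size-literalFormula : ∀ s → size (literalFormula s j) ≡ 1
  size-literalFormula true  = refl
  size-literalFormula false = refl

isRestriction-∧ : ∀ (ρ : PartialAssignment N n) φ ψ r r' → IsRestriction ρ φ r → IsRestriction ρ ψ r' →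
                  IsRestriction ρ (φ ∧ᶜ ψ) (r ∧ʳ r')
isRestriction-∧ ρ φ ψ (inj₁ false) r' φ≡ ψ≡ = λ y → cong (_∧ evalᶜ ψ (extend ρ y)) (φ≡ y)
isRestriction-∧ ρ φ ψ (inj₁ true) (inj₁ c) φ≡ ψ≡ = λ y → cong₂ _∧_ (φ≡ y) (ψ≡ y)
isRestriction-∧ ρ φ ψ (inj₁ true) (inj₂ χ) φ≡ (χ≡ , χ≤) =
  (λ y → trans (χ≡ y) (cong (_∧ evalᶜ ψ (extend ρ y)) (sym (φ≡ y)))) , ≤-trans χ≤ (m≤n+m _ _)
isRestriction-∧ ρ φ ψ (inj₂ χ) (inj₁ false) φ≡ ψ≡ =
  λ y → trans (cong (evalᶜ φ (extend ρ y) ∧_) (ψ≡ y)) (∧-zeroʳ _)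
isRestriction-∧ ρ φ ψ (inj₂ χ) (inj₁ true) (χ≡ , χ≤) ψ≡ =
  (λ y → trans (χ≡ y) (sym (trans (cong (evalᶜ φ (extend ρ y) ∧_) (ψ≡ y)) (∧-identityʳ _))))
  , ≤-trans χ≤ (m≤m+n _ _)
isRestriction-∧ ρ φ ψ (inj₂ χ) (inj₂ χ') (χ≡ , χ≤) (χ'≡ , χ'≤) =
  (λ y → cong₂ _∧_ (χ≡ y) (χ'≡ y)) , +-mono-≤ χ≤ χ'≤

isRestriction-∨ : ∀ (ρ : PartialAssignment N n) φ ψ r r' → IsRestriction ρ φ r → IsRestriction ρ ψ r' →
                  IsRestriction ρ (φ ∨ᶜ ψ) (r ∨ʳ r')
isRestriction-∨ ρ φ ψ (inj₁ true) r' φ≡ ψ≡ = λ y → cong (_∨ evalᶜ ψ (extend ρ y)) (φ≡ y)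
isRestriction-∨ ρ φ ψ (inj₁ false) (inj₁ c) φ≡ ψ≡ = λ y → cong₂ _∨_ (φ≡ y) (ψ≡ y)
isRestriction-∨ ρ φ ψ (inj₁ false) (inj₂ χ) φ≡ (χ≡ , χ≤) =
  (λ y → trans (χ≡ y) (cong (_∨ evalᶜ ψ (extend ρ y)) (sym (φ≡ y)))) , ≤-trans χ≤ (m≤n+m _ _)
isRestriction-∨ ρ φ ψ (inj₂ χ) (inj₁ true) φ≡ ψ≡ =
  λ y → trans (cong (evalᶜ φ (extend ρ y) ∨_) (ψ≡ y)) (∨-zeroʳ _)
isRestriction-∨ ρ φ ψ (inj₂ χ) (inj₁ false) (χ≡ , χ≤) ψ≡ =
  (λ y → trans (χ≡ y) (sym (trans (cong (evalᶜ φ (extend ρ y) ∨_) (ψ≡ y)) (∨-identityʳ _))))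
  , ≤-trans χ≤ (m≤m+n _ _)
isRestriction-∨ ρ φ ψ (inj₂ χ) (inj₂ χ') (χ≡ , χ≤) (χ'≡ , χ'≤) =
  (λ y → cong₂ _∨_ (χ≡ y) (χ'≡ y)) , +-mono-≤ χ≤ χ'≤

restrict-isRestriction : ∀ (ρ : PartialAssignment N n) φ → IsRestriction ρ φ (restrict ρ φ)
restrict-isRestriction ρ (lit s i) = isRestriction-lit ρ s i
restrict-isRestriction ρ (con c)   = λ y → refl
restrict-isRestriction ρ (φ ∧ᶜ ψ)  =
  isRestriction-∧ ρ φ ψ _ _ (restrict-isRestriction ρ φ) (restrict-isRestriction ρ ψ)
restrict-isRestriction ρ (φ ∨ᶜ ψ)  =
  isRestriction-∨ ρ φ ψ _ _ (restrict-isRestriction ρ φ) (restrict-isRestriction ρ ψ)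

LowerBound : ((Fin n → Bool) → Bool) → ℕ → Set
LowerBound G L = ∀ φ → Computes φ G → L ≤ size φ

-- A restriction of a formula computing a non-constant G is a formula for G.
lowerBound-restrict : ∀ {G : (Fin n → Bool) → Bool} {L y₀ y₁} → LowerBound G L → G y₀ ≡ false → G y₁ ≡ true →
  ∀ (ρ : PartialAssignment N n) φ → (∀ y → evalᶜ φ (extend ρ y) ≡ G y) → L ≤ leaves (unfixed ρ) φ
lowerBound-restrict {G = G} {y₀ = y₀} {y₁} bound G₀ G₁ ρ φ φ≡G
  with restrict ρ φ | restrict-isRestriction ρ φ
... | inj₁ c | φ≡c = ⊥-elim (false≢true (begin
  false                  ≡⟨ sym G₀ ⟩
  G y₀                   ≡⟨ sym (φ≡G y₀) ⟩
  evalᶜ φ (extend ρ y₀)  ≡⟨ trans (φ≡c y₀) (sym (φ≡c y₁)) ⟩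
  evalᶜ φ (extend ρ y₁)  ≡⟨ φ≡G y₁ ⟩
  G y₁                   ≡⟨ G₁ ⟩
  true                   ∎))
  where open ≡-Reasoning
... | inj₂ ψ | (ψ≡φ , ψ≤) = ≤-trans (bound ψ (λ y → trans (ψ≡φ y) (φ≡G y))) ψ≤

-- Formulas in the variables y, u, v of MAJ₃(G(y), u, v)

data Role (n : ℕ) : Set where
  old : Fin n → Role n
  u v : Role n

swap : Role n → Role n
swap (old j) = old j
swap u       = v
swap v       = u

isU isV isOld : Role n → ℕ
isU u = 1
isU _ = 0
isV v = 1
isV _ = 0
isOld (old _) = 1
isOld _       = 0

isU+isV+isOld : ∀ (r : Role n) → isU r + isV r + isOld r ≡ 1
isU+isV+isOld (old _) = refl
isU+isV+isOld u       = refl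
isU+isV+isOld v       = refl

fixUV : Bool → Bool → Role n → Bool ⊎ Fin n
fixUV a b (old j) = inj₂ j
fixUV a b u       = inj₁ a
fixUV a b v       = inj₁ b

module Roles (role : Fin N → Role n) where

  assign : (Fin n → Bool) → Bool → Bool → Fin N → Bool
  assign y a b = extend (fixUV a b ∘ role) y

  #u #v #old : Formulaᶜ N → ℕ
  #u   = leaves (isU ∘ role)
  #v   = leaves (isV ∘ role)
  #old = leaves (isOld ∘ role)

  size-#u+#v+#old : ∀ φ → size φ ≡ #u (embed φ) + #v (embed φ) + #old (embed φ)
  size-#u+#v+#old φ = begin
    size φ                                             ≡⟨ size-leaves φ ⟩
    leaves (λ _ → 1) (embed φ)                         ≡⟨ leaves-cong (sym ∘ isU+isV+isOld ∘ role) (embed φ) ⟩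
    leaves (λ i → isU (role i) + isV (role i) + isOld (role i)) (embed φ)
                                                       ≡⟨ leaves-+ _ (isOld ∘ role) (embed φ) ⟩
    leaves (λ i → isU (role i) + isV (role i)) (embed φ) + #old (embed φ)
                                                       ≡⟨ cong (_+ #old (embed φ)) (leaves-+ _ _ (embed φ)) ⟩
    #u (embed φ) + #v (embed φ) + #old (embed φ)       ∎
    where open ≡-Reasoning

  #old-unfixed : ∀ a b φ → leaves (unfixed (fixUV a b ∘ role)) φ ≡ #old φ
  #old-unfixed a b = leaves-cong (λ i → unfixed-fixUV (role i))
    where
    unfixed-fixUV : ∀ r → [ (λ _ → 0) , (λ _ → 1) ]′ (fixUV a b r) ≡ isOld r
    unfixed-fixUV (old _) = refl
    unfixed-fixUV u       = refl
    unfixed-fixUV v       = refl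

  assign-u : ∀ y a a' b i → isU (role i) ≡ 0 → assign y a b i ≡ assign y a' b i
  assign-u y a a' b i = agree (role i)
    where
    agree : ∀ r → isU r ≡ 0 → [ id , y ]′ (fixUV a b r) ≡ [ id , y ]′ (fixUV a' b r)
    agree (old _) _ = refl
    agree v       _ = refl

  assign-v : ∀ y a b b' i → isV (role i) ≡ 0 → assign y a b i ≡ assign y a b' i
  assign-v y a b b' i = agree (role i)
    where
    agree : ∀ r → isV r ≡ 0 → [ id , y ]′ (fixUV a b r) ≡ [ id , y ]′ (fixUV a b' r)
    agree (old _) _ = refl
    agree u       _ = refl

  u-irrelevant : ∀ φ → #u φ ≡ 0 → ∀ y a a' b → evalᶜ φ (assign y a b) ≡ evalᶜ φ (assign y a' b)
  u-irrelevant φ none y a a' b = evalᶜ-local (isU ∘ role) φ (assign-u y a a' b) none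

  -- P and Q collect the siblings on the path to the only u-leaf, whose sign is `sign`.
  record UPath (φ : Formulaᶜ N) : Set where
    field
      sign     : Bool
      P Q      : Formulaᶜ N
      P-u-free : #u P ≡ 0
      Q-u-free : #u Q ≡ 0
      siblings : ∀ w → leaves w P + leaves w Q ≤ leaves w φ
      path     : ∀ y b → Path (evalᶜ φ (assign y (literal sign false) b))
                              (evalᶜ φ (assign y (literal sign true) b))
                              (evalᶜ P (assign y (literal sign false) b))
                              (evalᶜ Q (assign y (literal sign false) b))

  upath-lit : ∀ s i → isU (role i) ≡ 1 → UPath (lit s i)
  upath-lit s i isu = record
    { sign = s ; P = con true ; Q = con false ; P-u-free = refl ; Q-u-free = refl
    ; siblings = λ _ → z≤n ; path = λ y b → leaf s y b (role i) isu }
    where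
    leaf : ∀ s y b r → isU r ≡ 1 →
      Path (literal s ([ id , y ]′ (fixUV (literal s false) b r)))
           (literal s ([ id , y ]′ (fixUV (literal s true) b r)))
           true false
    leaf true  y b u _ = path-leaf
    leaf false y b u _ = path-leaf

  upath-∧ : ∀ φ ψ → #u φ ≡ 0 → UPath ψ → UPath (φ ∧ᶜ ψ)
  upath-∧ φ ψ none D = record
    { sign = sign ; P = φ ∧ᶜ P ; Q = Q ; P-u-free = cong₂ _+_ none P-u-free ; Q-u-free = Q-u-free
    ; siblings = λ w → ≤-trans (≤-reflexive (+-assoc (leaves w φ) _ _)) (+-monoʳ-≤ (leaves w φ) (siblings w))
    ; path = λ y b → path-∧ (u-irrelevant φ none y _ _ b) (path y b) }
    where open UPath D

  upath-∨ : ∀ φ ψ → #u φ ≡ 0 → UPath ψ → UPath (φ ∨ᶜ ψ)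
  upath-∨ φ ψ none D = record
    { sign = sign ; P = P ; Q = φ ∨ᶜ Q ; P-u-free = P-u-free ; Q-u-free = cong₂ _+_ none Q-u-free
    ; siblings = λ w → ≤-trans (≤-reflexive (x∙yz≈y∙xz (leaves w P) (leaves w φ) _))
                               (+-monoʳ-≤ (leaves w φ) (siblings w))
    ; path = λ y b → path-∨ (u-irrelevant φ none y _ _ b) (path y b) }
    where open UPath D

  upath-transport : ∀ {φ φ'} → (∀ x → evalᶜ φ x ≡ evalᶜ φ' x) → (∀ w → leaves w φ ≡ leaves w φ') →
                    UPath φ → UPath φ'
  upath-transport φ≡φ' leaves≡ D = record
    { sign = sign ; P = P ; Q = Q ; P-u-free = P-u-free ; Q-u-free = Q-u-free
    ; siblings = λ w → subst (_ ≤_) (leaves≡ w) (siblings w)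
    ; path = λ y b → path-cong (φ≡φ' _) (φ≡φ' _) (path y b) }
    where open UPath D

  upath : ∀ φ → #u φ ≡ 1 → UPath φ
  upath (lit s i) once = upath-lit s i once
  upath (φ ∧ᶜ ψ) once with m+n≡1⇒m≡0∧n≡1∨m≡1∧n≡0 (#u φ) once
  ... | inj₁ (φ0 , ψ1) = upath-∧ φ ψ φ0 (upath ψ ψ1)
  ... | inj₂ (φ1 , ψ0) =
    upath-transport (λ x → ∧-comm (evalᶜ ψ x) _) (λ w → +-comm (leaves w ψ) _) (upath-∧ ψ φ ψ0 (upath φ φ1))
  upath (φ ∨ᶜ ψ) once with m+n≡1⇒m≡0∧n≡1∨m≡1∧n≡0 (#u φ) once
  ... | inj₁ (φ0 , ψ1) = upath-∨ φ ψ φ0 (upath ψ ψ1)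
  ... | inj₂ (φ1 , ψ0) =
    upath-transport (λ x → ∨-comm (evalᶜ ψ x) _) (λ w → +-comm (leaves w ψ) _) (upath-∨ ψ φ ψ0 (upath φ φ1))

  v-occurs : ∀ φ y a → evalᶜ φ (assign y a false) ≡ false → evalᶜ φ (assign y a true) ≡ true → 1 ≤ #v φ
  v-occurs φ y a φ₀ φ₁ = occurs (isV ∘ role) φ (assign-v y a false true) (λ φ₀≡φ₁ → false≢true (begin
    false                        ≡⟨ sym φ₀ ⟩
    evalᶜ φ (assign y a false)   ≡⟨ φ₀≡φ₁ ⟩
    evalᶜ φ (assign y a true)    ≡⟨ φ₁ ⟩
    true                         ∎))
    where open ≡-Reasoning

-- The lower bound L(MAJ₃(G, u, v)) ≥ L(G) + 4

module MajorityLowerBound (role : Fin N → Role n) {G : (Fin n → Bool) → Bool} {L : ℕ}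
  (1≤L : 1 ≤ L) (bound : LowerBound G L) {y₀ y₁ : Fin n → Bool} (G₀ : G y₀ ≡ false) (G₁ : G y₁ ≡ true)
  (φ : Formula N) (majority : ∀ y a b → eval φ (Roles.assign role y a b) ≡ MAJ3 (G y) a b) where

  open Roles role

  φᶜ : Formulaᶜ N
  φᶜ = embed φ

  value : ∀ y a b → evalᶜ φᶜ (assign y a b) ≡ MAJ3 (G y) a b
  value y a b = trans (evalᶜ-embed φ _) (majority y a b)

  #old-bound : ∀ a b χ → (∀ y → evalᶜ χ (assign y a b) ≡ G y) → L ≤ #old χ
  #old-bound a b χ χ≡G =
    subst (L ≤_) (#old-unfixed a b χ) (lowerBound-restrict bound G₀ G₁ (fixUV a b ∘ role) χ χ≡G)

  u-occurs : 1 ≤ #u φᶜ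
  u-occurs = occurs (isU ∘ role) φᶜ (assign-u y₁ false true false) (λ φ₀≡φ₁ → false≢true (begin
    false                              ≡⟨ cong (λ g → MAJ3 g false false) (sym G₁) ⟩
    MAJ3 (G y₁) false false            ≡⟨ sym (value y₁ false false) ⟩
    evalᶜ φᶜ (assign y₁ false false)   ≡⟨ φ₀≡φ₁ ⟩
    evalᶜ φᶜ (assign y₁ true false)    ≡⟨ value y₁ true false ⟩
    MAJ3 (G y₁) true false             ≡⟨ cong (λ g → MAJ3 g true false) G₁ ⟩
    true                               ∎))
    where open ≡-Reasoning

  many-u-and-v : 2 ≤ #u φᶜ → 2 ≤ #v φᶜ → L + 4 ≤ size φ
  many-u-and-v 2≤#u 2≤#v = begin
    L + 4                           ≡⟨ +-comm L 4 ⟩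
    2 + 2 + L                       ≤⟨ +-mono-≤ (+-mono-≤ 2≤#u 2≤#v) L≤#old ⟩
    #u φᶜ + #v φᶜ + #old φᶜ         ≡⟨ sym (size-#u+#v+#old φ) ⟩
    size φ                          ∎
    where
    open ≤-Reasoning
    L≤#old : L ≤ #old φᶜ
    L≤#old = #old-bound true false φᶜ (λ y → trans (value y true false) (MAJ3-true-false (G y)))

  single-u : #u φᶜ ≡ 1 → L + 4 ≤ size φ
  single-u once = begin
    L + 4                           ≡⟨ +-comm L 4 ⟩
    3 + (1 + L)                     ≤⟨ +-monoʳ-≤ 3 (+-monoˡ-≤ L 1≤L) ⟩
    1 + 2 + (L + L)                 ≤⟨ +-mono-≤ (+-mono-≤ (≤-reflexive (sym once)) 2≤#v) 2L≤#old ⟩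
    #u φᶜ + #v φᶜ + #old φᶜ         ≡⟨ sym (size-#u+#v+#old φ) ⟩
    size φ                          ∎
    where
    open ≤-Reasoning
    open UPath (upath φᶜ once)

    at : (Fin n → Bool) → Bool → Fin N → Bool
    at y b = assign y (literal sign false) b

    majorityPath : ∀ y b → MajorityPath sign (G y) b (evalᶜ P (at y b)) (evalᶜ Q (at y b))
    majorityPath y b = path-cong (value y _ b) (value y _ b) (path y b)

    P≡G : ∀ y → evalᶜ P (at y false) ≡ G y
    P≡G y = majorityPath-v0 sign (G y) (majorityPath y false)

    Q≡G : ∀ y → evalᶜ Q (at y true) ≡ G y
    Q≡G y = majorityPath-v1 sign (G y) (majorityPath y true)

    1≤#vP : 1 ≤ #v P
    1≤#vP = v-occurs P y₀ _ (trans (P≡G y₀) G₀) (majorityPath-v1-false sign G₀ (majorityPath y₀ true))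

    1≤#vQ : 1 ≤ #v Q
    1≤#vQ = v-occurs Q y₁ _ (majorityPath-v0-true sign G₁ (majorityPath y₁ false)) (trans (Q≡G y₁) G₁)

    2≤#v : 2 ≤ #v φᶜ
    2≤#v = ≤-trans (+-mono-≤ 1≤#vP 1≤#vQ) (siblings (isV ∘ role))

    2L≤#old : L + L ≤ #old φᶜ
    2L≤#old = ≤-trans (+-mono-≤ (#old-bound _ false P P≡G) (#old-bound _ true Q Q≡G)) (siblings (isOld ∘ role))

  few-u : #u φᶜ ≤ 1 → L + 4 ≤ size φ
  few-u #u≤1 = single-u (≤-antisym #u≤1 u-occurs)

majority-swap : ∀ (role : Fin N → Role n) {G : (Fin n → Bool) → Bool} φ →
  (∀ y a b → eval φ (Roles.assign role y a b) ≡ MAJ3 (G y) a b) →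
  (∀ y a b → eval φ (Roles.assign (swap ∘ role) y a b) ≡ MAJ3 (G y) a b)
majority-swap role {G} φ majority y a b =
  trans (eval-cong φ (λ i → assign-swap (role i))) (trans (majority y b a) (MAJ3-comm (G y) b a))
  where
  assign-swap : ∀ r → [ id , y ]′ (fixUV a b (swap r)) ≡ [ id , y ]′ (fixUV b a r)
  assign-swap (old _) = refl
  assign-swap u       = refl
  assign-swap v       = refl

#u-swap : ∀ (role : Fin N → Role n) φ → Roles.#u (swap ∘ role) φ ≡ Roles.#v role φ
#u-swap role = leaves-cong (λ i → isU-swap (role i))
  where
  isU-swap : ∀ r → isU (swap r) ≡ isV r
  isU-swap (old _) = refl
  isU-swap u       = refl
  isU-swap v       = refl

majority-lowerBound : ∀ (role : Fin N → Role n) {G : (Fin n → Bool) → Bool} {L} → 1 ≤ L → LowerBound G L →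
  ∀ {y₀ y₁} → G y₀ ≡ false → G y₁ ≡ true →
  ∀ φ → (∀ y a b → eval φ (Roles.assign role y a b) ≡ MAJ3 (G y) a b) → L + 4 ≤ size φ
majority-lowerBound role {G} 1≤L bound G₀ G₁ φ majority
  with Roles.#u role (embed φ) ≤? 1 | Roles.#v role (embed φ) ≤? 1
... | yes #u≤1 | _ = MajorityLowerBound.few-u role 1≤L bound G₀ G₁ φ majority #u≤1
... | no _ | yes #v≤1 = MajorityLowerBound.few-u (swap ∘ role) 1≤L bound G₀ G₁ φ
                          (majority-swap role {G} φ majority) (subst (_≤ 1) (sym (#u-swap role (embed φ))) #v≤1)
... | no #u≰1 | no #v≰1 = MajorityLowerBound.many-u-and-v role 1≤L bound G₀ G₁ φ majority (≰⇒> #u≰1) (≰⇒> #v≰1)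

weakenRole : Role n → Role (suc n)
weakenRole (old j) = old (suc j)
weakenRole u       = u
weakenRole v       = v

lastTwo : (n : ℕ) → Fin (suc (suc n)) → Role n
lastTwo zero    zero       = u
lastTwo zero    (suc zero) = v
lastTwo (suc n) zero       = old zero
lastTwo (suc n) (suc i)    = weakenRole (lastTwo n i)

lastTwo-old : ∀ n (i : Fin n) → lastTwo n (inject₁ (inject₁ i)) ≡ old i
lastTwo-old (suc n) zero    = refl
lastTwo-old (suc n) (suc i) = cong weakenRole (lastTwo-old n i)

lastTwo-u : ∀ n → lastTwo n (inject₁ (fromℕ n)) ≡ u
lastTwo-u zero    = refl
lastTwo-u (suc n) = cong weakenRole (lastTwo-u n)

lastTwo-v : ∀ n → lastTwo n (fromℕ (suc n)) ≡ v
lastTwo-v zero    = refl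
lastTwo-v (suc n) = cong weakenRole (lastTwo-v n)

newU newV : ∀ h → Fin (nv (suc h))
newU h = inject₁ (fromℕ (nv h))
newV h = fromℕ (suc (nv h))

URecMAJ-suc : ∀ h x → URecMAJ (suc h) x ≡ MAJ3 (URecMAJ h (x ∘ inject₁ ∘ inject₁)) (x (newU h)) (x (newV h))
URecMAJ-suc zero    x = refl
URecMAJ-suc (suc h) x = refl

URecMAJ-cong : ∀ h {x x'} → (∀ i → x i ≡ x' i) → URecMAJ h x ≡ URecMAJ h x'
URecMAJ-cong zero          x≡x' = x≡x' zero
URecMAJ-cong (suc zero)    x≡x' = MAJ3-cong (x≡x' _) (x≡x' _) (x≡x' _)
URecMAJ-cong (suc (suc h)) x≡x' = MAJ3-cong (URecMAJ-cong (suc h) (x≡x' ∘ inject₁ ∘ inject₁)) (x≡x' _) (x≡x' _)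

URecMAJ-const : ∀ h b → URecMAJ h (λ _ → b) ≡ b
URecMAJ-const zero    b = refl
URecMAJ-const (suc h) b = begin
  URecMAJ (suc h) (λ _ → b)      ≡⟨ URecMAJ-suc h _ ⟩
  MAJ3 (URecMAJ h (λ _ → b)) b b ≡⟨ cong (λ g → MAJ3 g b b) (URecMAJ-const h b) ⟩
  MAJ3 b b b                     ≡⟨ MAJ3-idem b ⟩
  b                              ∎
  where open ≡-Reasoning

URecMAJ-majority : ∀ h φ → Computes φ (URecMAJ (suc h)) →
  ∀ y a b → eval φ (Roles.assign (lastTwo (nv h)) y a b) ≡ MAJ3 (URecMAJ h y) a b
URecMAJ-majority h φ computes y a b = begin
  eval φ x                         ≡⟨ computes x ⟩
  URecMAJ (suc h) x                ≡⟨ URecMAJ-suc h x ⟩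
  MAJ3 (URecMAJ h (x ∘ inject₁ ∘ inject₁)) (x (newU h)) (x (newV h))
     ≡⟨ MAJ3-cong (URecMAJ-cong h (λ i → cong ([ id , y ]′ ∘ fixUV a b) (lastTwo-old (nv h) i)))
                   (cong ([ id , y ]′ ∘ fixUV a b) (lastTwo-u (nv h)))
                   (cong ([ id , y ]′ ∘ fixUV a b) (lastTwo-v (nv h))) ⟩
  MAJ3 (URecMAJ h y) a b           ∎
  where
  open ≡-Reasoning
  x : Fin (nv (suc h)) → Bool
  x = Roles.assign (lastTwo (nv h)) y a b

size-positive : ∀ (φ : Formula n) → 1 ≤ size φ
size-positive (pos i)   = s≤s z≤n
size-positive (neg i)   = s≤s z≤n
size-positive (and φ ψ) = ≤-trans (size-positive φ) (m≤m+n _ _)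
size-positive (or φ ψ)  = ≤-trans (size-positive φ) (m≤m+n _ _)

4h+1+4≡4[1+h]+1 : ∀ h → 4 * h + 1 + 4 ≡ 4 * suc h + 1
4h+1+4≡4[1+h]+1 = solve-∀
  where open import Data.Nat.Tactic.RingSolver

URecMAJ-lowerBound : ∀ h → LowerBound (URecMAJ h) (4 * h + 1)
URecMAJ-lowerBound zero    φ _         = size-positive φ
URecMAJ-lowerBound (suc h) φ computes = subst (_≤ size φ) (4h+1+4≡4[1+h]+1 h)
  (majority-lowerBound (lastTwo (nv h)) (m≤n+m 1 (4 * h)) (URecMAJ-lowerBound h)
    (URecMAJ-const h false) (URecMAJ-const h true) φ (URecMAJ-majority h φ computes))

rename : ∀ {m k} → (Fin m → Fin k) → Formula m → Formula k
rename f (pos i)   = pos (f i)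
rename f (neg i)   = neg (f i)
rename f (and φ ψ) = and (rename f φ) (rename f ψ)
rename f (or φ ψ)  = or (rename f φ) (rename f ψ)

eval-rename : ∀ {m k} (f : Fin m → Fin k) φ x → eval (rename f φ) x ≡ eval φ (x ∘ f)
eval-rename f (pos i)   x = refl
eval-rename f (neg i)   x = refl
eval-rename f (and φ ψ) x = cong₂ _∧_ (eval-rename f φ x) (eval-rename f ψ x)
eval-rename f (or φ ψ)  x = cong₂ _∨_ (eval-rename f φ x) (eval-rename f ψ x)

size-rename : ∀ {m k} (f : Fin m → Fin k) φ → size (rename f φ) ≡ size φ
size-rename f (pos i)   = refl
size-rename f (neg i)   = refl
size-rename f (and φ ψ) = cong₂ _+_ (size-rename f φ) (size-rename f ψ)
size-rename f (or φ ψ)  = cong₂ _+_ (size-rename f φ) (size-rename f ψ)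

monotone-rename : ∀ {m k} (f : Fin m → Fin k) {φ} → Monotone φ → Monotone (rename f φ)
monotone-rename f (pos i)   = pos (f i)
monotone-rename f (and p q) = and (monotone-rename f p) (monotone-rename f q)
monotone-rename f (or p q)  = or (monotone-rename f p) (monotone-rename f q)

URecMAJ-formula : ∀ h → Formula (nv h)
URecMAJ-formula zero    = pos zero
URecMAJ-formula (suc h) =
  or (and (rename (inject₁ ∘ inject₁) (URecMAJ-formula h)) (or (pos (newU h)) (pos (newV h))))
     (and (pos (newU h)) (pos (newV h)))

URecMAJ-formula-monotone : ∀ h → Monotone (URecMAJ-formula h)
URecMAJ-formula-monotone zero    = pos zero
URecMAJ-formula-monotone (suc h) =
  or (and (monotone-rename _ (URecMAJ-formula-monotone h)) (or (pos _) (pos _))) (and (pos _) (pos _))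

URecMAJ-formula-computes : ∀ h → Computes (URecMAJ-formula h) (URecMAJ h)
URecMAJ-formula-computes zero    x = refl
URecMAJ-formula-computes (suc h) x = begin
  (eval (rename (inject₁ ∘ inject₁) (URecMAJ-formula h)) x ∧ (x (newU h) ∨ x (newV h))) ∨ (x (newU h) ∧ x (newV h))
     ≡⟨ cong (λ g → (g ∧ (x (newU h) ∨ x (newV h))) ∨ (x (newU h) ∧ x (newV h)))
             (trans (eval-rename _ (URecMAJ-formula h) x) (URecMAJ-formula-computes h _)) ⟩
  (URecMAJ h (x ∘ inject₁ ∘ inject₁) ∧ (x (newU h) ∨ x (newV h))) ∨ (x (newU h) ∧ x (newV h))
     ≡⟨ sym (MAJ3-factor (URecMAJ h (x ∘ inject₁ ∘ inject₁)) (x (newU h)) (x (newV h))) ⟩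
  MAJ3 (URecMAJ h (x ∘ inject₁ ∘ inject₁)) (x (newU h)) (x (newV h))
     ≡⟨ sym (URecMAJ-suc h x) ⟩
  URecMAJ (suc h) x ∎
  where open ≡-Reasoning

URecMAJ-formula-size : ∀ h → size (URecMAJ-formula h) ≡ 4 * h + 1
URecMAJ-formula-size zero    = refl
URecMAJ-formula-size (suc h) = begin
  size (rename (inject₁ ∘ inject₁) (URecMAJ-formula h)) + 2 + 2
                                    ≡⟨ cong (λ s → s + 2 + 2) (size-rename _ (URecMAJ-formula h)) ⟩
  size (URecMAJ-formula h) + 2 + 2  ≡⟨ +-assoc (size (URecMAJ-formula h)) 2 2 ⟩
  size (URecMAJ-formula h) + 4      ≡⟨ cong (_+ 4) (URecMAJ-formula-size h) ⟩
  4 * h + 1 + 4                     ≡⟨ 4h+1+4≡4[1+h]+1 h ⟩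
  4 * suc h + 1                     ∎
  where open ≡-Reasoning

theorem5p1 : (h : ℕ) → 1 ≤ h →
    FormulaSizeIs (URecMAJ h) (4 * h + 1) × MonotoneFormulaSizeIs (URecMAJ h) (4 * h + 1)
theorem5p1 h _ =
  ((URecMAJ-formula h , URecMAJ-formula-computes h , URecMAJ-formula-size h) , URecMAJ-lowerBound h) ,
  ((URecMAJ-formula h , URecMAJ-formula-monotone h , URecMAJ-formula-computes h , URecMAJ-formula-size h) ,
   λ φ _ → URecMAJ-lowerBound h φ)
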